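{- Let $R=(X,\prec)$ be an interval order with Fishburn matrix $M$, and let $x,y\in X$ be represented by cells $c_x$ and $c_y$ of $M$. (1) The cell $c_x$ is strictly SW of $c_y$ if and only if $X$ contains two elements $u,v$ which together with $x,y$ induce a copy of $\mathbf{3+1}$ in $R$ such that $u\prec x\prec v$ and $y$ is incomparable to each of $u,x,v$. (2) The cell $c_x$ is strictly NW of $c_y$ if and only if $X$ contains two elements $u,v$ which together with $x,y$ induce a copy of $\mathbf{N}$ in $R$ such that $u\prec y$, $u\prec v$ and $x\prec v$, and the remaining pairs among $u,v,x,y$ are incomparable. In particular, $R$ is $\mathbf{3+1}$-free if and only if $M$ has no two distinct nonzero cells in strictly SW position (one strictly SW of the other), and $R$ is $\mathbf{N}$-free if and only if $M$ has no two distinct nonzero cells in strictly NW position.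
   Context: Posets are finite. $\mathbf{2+2}$ is the poset on $\{a,b,c,d\}$ with exactly the relations $a<b$, $c<d$; $\mathbf{3+1}$ is the poset on $\{a,b,c,d\}$ with exactly $a<b<c$ (and $a<c$), $d$ incomparable to all; $\mathbf{N}$ is the poset on $\{a,b,c,d\}$ with exactly the relations $a<c$, $b<c$, $b<d$. A poset is $P$-free if it has no induced subposet isomorphic to $P$. An interval order is a $\mathbf{2+2}$-free poset. Every interval order $(X,\prec)$ has a unique minimal interval representation: a map $x\mapsto I(x)=[l_x,r_x]$ with positive integer endpoints such that $x\prec y$ iff $r_x<l_y$, and for some $m$ every $k\in\{1,\dots,m\}$ is the right endpoint of some $I(x)$ and the left endpoint of some $I(y)$. The Fishburn matrix of $R$ is the $m\times m$ matrix $M$ with $M_{i,j}=|\{x: I(x)=[i,j]\}|$ (rows numbered top to bottom); $x$ is represented by cell $(i,j)$ if $I(x)=[i,j]$. For cells $c=(i,j)$, $c'=(i',j')$ with $i\le j$, $i'\le j'$: $c$ is greater than $c'$ if $j'<i$; they are comparable if one is greater than the other. $c$ is strictly SW of $c'$ (equivalently $c'$ strictly NE of $c$) if $i>i'$ and $j<j'$; $c$ is strictly SE of $c'$ (equivalently $c'$ strictly NW of $c$) if $c,c'$ are incomparable and $i>i'$, $j>j'$. -}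

module Defs where

open import Data.Nat using (ℕ; _≤_; _<_; _>_)
open import Data.Fin using (Fin)
open import Data.Product using (_×_; _,_; ∃-syntax; proj₁; proj₂)
open import Data.Sum using (_⊎_)
open import Relation.Nullary using (¬_)
open import Relation.Binary.PropositionalEquality using (_≡_; _≢_)
open import Function.Bundles using (_⇔_)

Incomp : ∀ {A : Set} → (A → A → Set) → A → A → Set
Incomp _≺_ a b = ¬ (a ≺ b) × ¬ (b ≺ a)

record IsStrictPoset {n : ℕ} (_≺_ : Fin n → Fin n → Set) : Set where
  field
    irrefl : ∀ x → ¬ (x ≺ x)
    trans  : ∀ {x y z} → x ≺ y → y ≺ z → x ≺ z

Has2+2 : ∀ {n : ℕ} → (Fin n → Fin n → Set) → Set
Has2+2 _≺_ = ∃[ a ] ∃[ b ] ∃[ c ] ∃[ d ]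
  (a ≺ b) × (c ≺ d) × Incomp _≺_ a c × Incomp _≺_ a d × Incomp _≺_ b c × Incomp _≺_ b d

Has3+1 : ∀ {n : ℕ} → (Fin n → Fin n → Set) → Set
Has3+1 _≺_ = ∃[ a ] ∃[ b ] ∃[ c ] ∃[ d ]
  (a ≺ b) × (b ≺ c) × (a ≺ c) × Incomp _≺_ d a × Incomp _≺_ d b × Incomp _≺_ d c

HasN : ∀ {n : ℕ} → (Fin n → Fin n → Set) → Set
HasN _≺_ = ∃[ a ] ∃[ b ] ∃[ c ] ∃[ d ]
  (a ≺ c) × (b ≺ c) × (b ≺ d) × Incomp _≺_ a b × Incomp _≺_ a d × Incomp _≺_ c d

record IsIntervalOrder {n : ℕ} (_≺_ : Fin n → Fin n → Set) : Set where
  field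
    poset   : IsStrictPoset _≺_
    free2+2 : ¬ Has2+2 _≺_

record IsMinimalRep {n : ℕ} (_≺_ : Fin n → Fin n → Set)
                    (l r : Fin n → ℕ) (m : ℕ) : Set where
  field
    l-pos   : ∀ x → 1 ≤ l x
    l≤r     : ∀ x → l x ≤ r x
    r≤m     : ∀ x → r x ≤ m
    rep     : ∀ x y → (x ≺ y) ⇔ (r x < l y)
    coverR  : ∀ k → 1 ≤ k → k ≤ m → ∃[ x ] (r x ≡ k)
    coverL  : ∀ k → 1 ≤ k → k ≤ m → ∃[ y ] (l y ≡ k)

Cell : Set
Cell = ℕ × ℕ

Greater : Cell → Cell → Set
Greater (i , j) (i' , j') = j' < i

Comparable : Cell → Cell → Set
Comparable c c' = Greater c c' ⊎ Greater c' c

StrictSW : Cell → Cell → Set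
StrictSW (i , j) (i' , j') = i > i' × j < j'

StrictSE : Cell → Cell → Set
StrictSE c@(i , j) c'@(i' , j') = ¬ Comparable c c' × i > i' × j > j'

StrictNW : Cell → Cell → Set
StrictNW c c' = StrictSE c' c

NonzeroCell : ∀ {n : ℕ} → (Fin n → ℕ) → (Fin n → ℕ) → Cell → Set
NonzeroCell l r (i , j) = ∃[ x ] (l x ≡ i × r x ≡ j)

-- In a minimal representation every k ∈ {1..m} is both a right and a left
-- endpoint. So if I(x) starts after I(y) starts, some u has its interval ending
-- in [l y , l x), i.e. u ≺ x but u overlaps y; if I(x) ends before I(y) ends,
-- some v has its interval starting in (r x , r y], i.e. x ≺ v but v overlaps y.
-- These u, v complete x, y to the 3+1 (for SW) or to the N (for NW); the
-- converse only reads endpoint inequalities off the comparabilities.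
module Submission where

open import Defs
open import Data.Nat using (ℕ; _≤_; _<_; s≤s; z≤n)
open import Data.Nat.Properties using (≤-refl; ≤-reflexive; ≤-trans; <⇒≤; <-trans; <-irrefl; ≤-<-trans; <-≤-trans; ≮⇒≥)
open import Data.Fin using (Fin)
open import Data.Product using (_×_; _,_; ∃-syntax; proj₁; swap)
open import Data.Sum using (inj₁; inj₂)
open import Relation.Nullary using (¬_)
open import Relation.Nullary.Negation using (contraposition)
open import Relation.Binary.PropositionalEquality using (_≢_; refl; sym; cong)
open import Function.Bundles using (_⇔_; mk⇔; Equivalence)
open import Function.Properties.Equivalence using () renaming (trans to ⇔-trans)

open Equivalence using (to; from)

¬-cong : ∀ {A B : Set} → A ⇔ B → (¬ A) ⇔ (¬ B)
¬-cong A⇔B = mk⇔ (contraposition (from A⇔B)) (contraposition (to A⇔B))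

StrictSW⇒≢ : ∀ {c c'} → StrictSW c c' → c ≢ c'
StrictSW⇒≢ (i'<i , _) c≡c' = <-irrefl (cong proj₁ (sym c≡c')) i'<i

StrictNW⇒≢ : ∀ {c c'} → StrictNW c c' → c ≢ c'
StrictNW⇒≢ (_ , i<i' , _) c≡c' = <-irrefl (cong proj₁ c≡c') i<i'

module _ {n : ℕ} (l r : Fin n → ℕ) where

  cell : Fin n → Cell
  cell x = l x , r x

  ∃cellPair⇔∃nonzeroCellPair : {Rel : Cell → Cell → Set} → (∀ {c c'} → Rel c c' → c ≢ c') →
    (∃[ x ] ∃[ y ] Rel (cell x) (cell y)) ⇔
    (∃[ c ] ∃[ c' ] NonzeroCell l r c × NonzeroCell l r c' × c ≢ c' × Rel c c')
  ∃cellPair⇔∃nonzeroCellPair Rel⇒≢ = mk⇔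
    (λ (x , y , rel) → cell x , cell y , (x , refl , refl) , (y , refl , refl) , Rel⇒≢ rel , rel)
    (λ { (_ , _ , (x , refl , refl) , (y , refl , refl) , _ , rel) → x , y , rel })

module _ {n : ℕ} (_≺_ : Fin n → Fin n → Set) where

  Has3+1At : Fin n → Fin n → Set
  Has3+1At x y = ∃[ u ] ∃[ v ] (u ≺ x) × (x ≺ v) × (u ≺ v) ×
    Incomp _≺_ y u × Incomp _≺_ y x × Incomp _≺_ y v

  HasNAt : Fin n → Fin n → Set
  HasNAt x y = ∃[ u ] ∃[ v ] (u ≺ y) × (u ≺ v) × (x ≺ v) ×
    Incomp _≺_ u x × Incomp _≺_ y x × Incomp _≺_ y v

  has3+1⇔∃Has3+1At : Has3+1 _≺_ ⇔ (∃[ x ] ∃[ y ] Has3+1At x y)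
  has3+1⇔∃Has3+1At = mk⇔
    (λ (a , b , c , d , p) → b , d , a , c , p)
    (λ (x , y , u , v , p) → u , x , v , y , p)

  hasN⇔∃HasNAt : HasN _≺_ ⇔ (∃[ x ] ∃[ y ] HasNAt x y)
  hasN⇔∃HasNAt = mk⇔
    (λ (a , b , c , d , ac , bc , bd , ab , ad , cd) →
      a , d , b , c , bd , bc , ac , swap ab , swap ad , swap cd)
    (λ (x , y , u , v , uy , uv , xv , ux , yx , yv) →
      x , u , v , y , xv , uv , uy , swap ux , swap yx , swap yv)

module MinimalRep {n : ℕ} {_≺_ : Fin n → Fin n → Set} {l r : Fin n → ℕ} {m : ℕ}
                  (R : IsMinimalRep _≺_ l r m) where
  open IsMinimalRep R

  ≺⇒r<l : ∀ {x y} → x ≺ y → r x < l y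
  ≺⇒r<l {x} {y} = to (rep x y)

  r<l⇒≺ : ∀ {x y} → r x < l y → x ≺ y
  r<l⇒≺ {x} {y} = from (rep x y)

  ⊀⇒l≤r : ∀ {x y} → ¬ (x ≺ y) → l y ≤ r x
  ⊀⇒l≤r x⊀y = ≮⇒≥ (contraposition r<l⇒≺ x⊀y)

  overlap⇒incomp : ∀ {x y} → l x ≤ r y → l y ≤ r x → Incomp _≺_ x y
  overlap⇒incomp lx≤ry ly≤rx =
    (λ x≺y → <-irrefl refl (<-≤-trans (≺⇒r<l x≺y) ly≤rx)) ,
    (λ y≺x → <-irrefl refl (<-≤-trans (≺⇒r<l y≺x) lx≤ry))

  rightEndpointIn : ∀ {a b} → 1 ≤ a → a < b → b ≤ m → ∃[ u ] (a ≤ r u × r u < b)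
  rightEndpointIn 1≤a (s≤s a≤k) b≤m with coverR _ (≤-trans 1≤a a≤k) (<⇒≤ b≤m)
  ... | u , refl = u , a≤k , ≤-refl

  leftEndpointIn : ∀ {a b} → a < b → b ≤ m → ∃[ v ] (a < l v × l v ≤ b)
  leftEndpointIn {a} a<b b≤m with coverL _ (s≤s z≤n) (≤-trans a<b b≤m)
  ... | v , lv≡1+a = v , ≤-reflexive (sym lv≡1+a) , ≤-trans (≤-reflexive lv≡1+a) a<b

  l≤m : ∀ x → l x ≤ m
  l≤m x = ≤-trans (l≤r x) (r≤m x)

  strictSW⇔Has3+1At : ∀ x y → StrictSW (cell l r x) (cell l r y) ⇔ Has3+1At _≺_ x y
  strictSW⇔Has3+1At x y = mk⇔ sw⇒3+1 3+1⇒sw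
    where
    sw⇒3+1 : StrictSW (cell l r x) (cell l r y) → Has3+1At _≺_ x y
    sw⇒3+1 (ly<lx , rx<ry)
      with u , ly≤ru , ru<lx ← rightEndpointIn (l-pos y) ly<lx (l≤m x)
         | v , rx<lv , lv≤ry ← leftEndpointIn rx<ry (r≤m y) =
      u , v , r<l⇒≺ ru<lx , r<l⇒≺ rx<lv , r<l⇒≺ ru<lv ,
      overlap⇒incomp ly≤ru (≤-trans (l≤r u) (<⇒≤ ru<ry)) ,
      overlap⇒incomp ly≤rx lx≤ry ,
      overlap⇒incomp (≤-trans ly≤rx (≤-trans (<⇒≤ rx<lv) (l≤r v))) lv≤ry
      where
      ly≤rx : l y ≤ r x
      ly≤rx = ≤-trans (<⇒≤ ly<lx) (l≤r x)
      lx≤ry : l x ≤ r y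
      lx≤ry = ≤-trans (l≤r x) (<⇒≤ rx<ry)
      ru<lv : r u < l v
      ru<lv = <-trans ru<lx (≤-<-trans (l≤r x) rx<lv)
      ru<ry : r u < r y
      ru<ry = <-≤-trans ru<lx lx≤ry

    3+1⇒sw : Has3+1At _≺_ x y → StrictSW (cell l r x) (cell l r y)
    3+1⇒sw (u , v , u≺x , x≺v , _ , (_ , u⊀y) , _ , (y⊀v , _)) =
      ≤-<-trans (⊀⇒l≤r u⊀y) (≺⇒r<l u≺x) , <-≤-trans (≺⇒r<l x≺v) (⊀⇒l≤r y⊀v)

  strictNW⇔HasNAt : ∀ x y → StrictNW (cell l r x) (cell l r y) ⇔ HasNAt _≺_ x y
  strictNW⇔HasNAt x y = mk⇔ nw⇒N N⇒nw
    where
    nw⇒N : StrictNW (cell l r x) (cell l r y) → HasNAt _≺_ x y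
    nw⇒N (incomparable , lx<ly , rx<ry)
      with u , lx≤ru , ru<ly ← rightEndpointIn (l-pos x) lx<ly (l≤m y)
         | v , rx<lv , lv≤ry ← leftEndpointIn rx<ry (r≤m y) =
      u , v , r<l⇒≺ ru<ly , r<l⇒≺ (<-trans ru<ly (≤-<-trans ly≤rx rx<lv)) , r<l⇒≺ rx<lv ,
      overlap⇒incomp (≤-trans (l≤r u) (<⇒≤ (<-≤-trans ru<ly ly≤rx))) lx≤ru ,
      overlap⇒incomp ly≤rx (≤-trans (<⇒≤ lx<ly) (l≤r y)) ,
      overlap⇒incomp (≤-trans ly≤rx (≤-trans (<⇒≤ rx<lv) (l≤r v))) lv≤ry
      where
      ly≤rx : l y ≤ r x
      ly≤rx = ≮⇒≥ (λ rx<ly → incomparable (inj₁ rx<ly))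

    N⇒nw : HasNAt _≺_ x y → StrictNW (cell l r x) (cell l r y)
    N⇒nw (u , v , u≺y , _ , x≺v , (u⊀x , _) , (y⊀x , x⊀y) , (y⊀v , _)) =
      (λ { (inj₁ rx<ly) → x⊀y (r<l⇒≺ rx<ly) ; (inj₂ ry<lx) → y⊀x (r<l⇒≺ ry<lx) }) ,
      ≤-<-trans (⊀⇒l≤r u⊀x) (≺⇒r<l u≺y) , <-≤-trans (≺⇒r<l x≺v) (⊀⇒l≤r y⊀v)

  has3+1⇔∃StrictSW : Has3+1 _≺_ ⇔ (∃[ x ] ∃[ y ] StrictSW (cell l r x) (cell l r y))
  has3+1⇔∃StrictSW = mk⇔
    (λ h → let (x , y , p) = to (has3+1⇔∃Has3+1At _≺_) h in x , y , from (strictSW⇔Has3+1At x y) p)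
    (λ (x , y , sw) → from (has3+1⇔∃Has3+1At _≺_) (x , y , to (strictSW⇔Has3+1At x y) sw))

  hasN⇔∃StrictNW : HasN _≺_ ⇔ (∃[ x ] ∃[ y ] StrictNW (cell l r x) (cell l r y))
  hasN⇔∃StrictNW = mk⇔
    (λ h → let (x , y , p) = to (hasN⇔∃HasNAt _≺_) h in x , y , from (strictNW⇔HasNAt x y) p)
    (λ (x , y , nw) → from (hasN⇔∃HasNAt _≺_) (x , y , to (strictNW⇔HasNAt x y) nw))

lemma1p2 : (n : ℕ) (_≺_ : Fin n → Fin n → Set) → IsIntervalOrder _≺_ →
    (l r : Fin n → ℕ) (m : ℕ) → IsMinimalRep _≺_ l r m →
    (∀ x y → StrictSW (l x , r x) (l y , r y) ⇔
       (∃[ u ] ∃[ v ] (u ≺ x) × (x ≺ v) × (u ≺ v) ×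
          Incomp _≺_ y u × Incomp _≺_ y x × Incomp _≺_ y v))
    × (∀ x y → StrictNW (l x , r x) (l y , r y) ⇔
       (∃[ u ] ∃[ v ] (u ≺ y) × (u ≺ v) × (x ≺ v) ×
          Incomp _≺_ u x × Incomp _≺_ y x × Incomp _≺_ y v))
    × ((¬ Has3+1 _≺_) ⇔
       (¬ (∃[ c ] ∃[ c' ] NonzeroCell l r c × NonzeroCell l r c' × c ≢ c' × StrictSW c c')))
    × ((¬ HasN _≺_) ⇔
       (¬ (∃[ c ] ∃[ c' ] NonzeroCell l r c × NonzeroCell l r c' × c ≢ c' × StrictNW c c')))
lemma1p2 n _≺_ _ l r m R =
  strictSW⇔Has3+1At ,
  strictNW⇔HasNAt ,
  ¬-cong (⇔-trans has3+1⇔∃StrictSW (∃cellPair⇔∃nonzeroCellPair l r StrictSW⇒≢)) ,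
  ¬-cong (⇔-trans hasN⇔∃StrictNW (∃cellPair⇔∃nonzeroCellPair l r StrictNW⇒≢))
  where open MinimalRep R
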